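{- Let $p$ be a prime. Two orders $\mathcal{O},\mathcal{O}'\subset B_p$ are of the same type if and only if there exists nonzero $c\in B_p$ such that $c\,\mathcal{O}^T c^{ -1} = \mathcal{O}'^T$.
   Context: $B_p$ is the quaternion algebra over $\mathbb{Q}$ ramified exactly at $p$ and $\infty$, with reduced trace $\mathrm{Tr}$. An order is a subring of $B_p$ containing $\mathbb{Z}$ that is a $\mathbb{Z}$-lattice of rank $4$. Two orders $\mathcal{O},\mathcal{O}'$ are of the same type if $c\mathcal{O}c^{ -1}=\mathcal{O}'$ for some nonzero $c\in B_p$. For an order $\mathcal{O}$, $\mathcal{O}^T := \{2a-\mathrm{Tr}(a) : a\in\mathcal{O}\}$. -}

module Defs where

open import Data.Nat as ℕ using (ℕ; _%_)
open import Data.Nat.Primality using (Prime)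
open import Data.Integer as ℤ using (ℤ; +_; -[1+_])
open import Data.Rational as Q using (ℚ; 0ℚ; 1ℚ)
open import Data.Fin using (Fin; zero; suc)
open import Data.Product using (Σ; ∃; _×_; _,_)
open import Relation.Binary.PropositionalEquality using (_≡_; _≢_)
open import Relation.Nullary using (¬_)
open import Data.Integer.Divisibility using () renaming (_∣_ to _∣ℤ_)

-- Explicit model of B_p (Pizer's presentation).
-- B_p ≅ (a,b / ℚ) :  i² = a, j² = b, k = ij = -ji, where
--   p = 2         : (a,b) = (-1,-1)
--   p ≡ 3 mod 4   : (a,b) = (-1,-p)
--   p ≡ 5 mod 8   : (a,b) = (-2,-p)
--   p ≡ 1 mod 8   : (a,b) = (-p,-q), q prime, q ≡ 3 mod 4, p not a square mod q
-- Each of these is the quaternion algebra over ℚ ramified exactly at {p,∞}.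

ℕtoℚ : ℕ → ℚ
ℕtoℚ n = (+ n) Q./ 1

data BpParams (p : ℕ) : ℚ → ℚ → Set where
  case2   : p ≡ 2 → BpParams p (Q.- 1ℚ) (Q.- 1ℚ)
  case3m4 : p % 4 ≡ 3 → BpParams p (Q.- 1ℚ) (Q.- ℕtoℚ p)
  case5m8 : p % 8 ≡ 5 → BpParams p (Q.- ℕtoℚ 2) (Q.- ℕtoℚ p)
  case1m8 : (q : ℕ) → Prime q → q % 4 ≡ 3 → p % 8 ≡ 1 →
            ¬ (∃ λ (x : ℤ) → (+ q) ∣ℤ (x ℤ.* x ℤ.- + p)) →
            BpParams p (Q.- ℕtoℚ p) (Q.- ℕtoℚ q)

-- Elements x0 + x1 i + x2 j + x3 k
record Quat : Set where
  constructor quat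
  field
    c0 c1 c2 c3 : ℚ

module QuatAlg (a b : ℚ) where
  open Q using (_+_; _*_; _-_; -_)

  infixl 6 _⊕_
  infixl 7 _⊗_

  _⊕_ : Quat → Quat → Quat
  quat x0 x1 x2 x3 ⊕ quat y0 y1 y2 y3 =
    quat (x0 + y0) (x1 + y1) (x2 + y2) (x3 + y3)

  ⊖_ : Quat → Quat
  ⊖ quat x0 x1 x2 x3 = quat (- x0) (- x1) (- x2) (- x3)

  _⊗_ : Quat → Quat → Quat
  quat x0 x1 x2 x3 ⊗ quat y0 y1 y2 y3 = quat
    (x0 * y0 + a * (x1 * y1) + b * (x2 * y2) - (a * b) * (x3 * y3))
    (x0 * y1 + x1 * y0 - b * (x2 * y3) + b * (x3 * y2))
    (x0 * y2 + x2 * y0 + a * (x1 * y3) - a * (x3 * y1))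
    (x0 * y3 + x3 * y0 + x1 * y2 - x2 * y1)

  sc : ℚ → Quat
  sc r = quat r 0ℚ 0ℚ 0ℚ

  𝟘 𝟙 : Quat
  𝟘 = sc 0ℚ
  𝟙 = sc 1ℚ

  _·_ : ℚ → Quat → Quat
  r · quat x0 x1 x2 x3 = quat (r * x0) (r * x1) (r * x2) (r * x3)

  Tr : Quat → ℚ
  Tr (quat x0 _ _ _) = x0 + x0

  Subset : Set₁
  Subset = Quat → Set

  _≐_ : Subset → Subset → Set
  S ≐ T = ∀ y → (S y → T y) × (T y → S y)

  lin : (Fin 4 → ℚ) → (Fin 4 → Quat) → Quat
  lin λs e = λs zero · e zero ⊕ λs (suc zero) · e (suc zero)
           ⊕ λs (suc (suc zero)) · e (suc (suc zero))
           ⊕ λs (suc (suc (suc zero))) · e (suc (suc (suc zero)))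

  ℤtoℚ : ℤ → ℚ
  ℤtoℚ n = n Q./ 1

  IsLattice4 : Subset → Set
  IsLattice4 O = Σ (Fin 4 → Quat) λ e →
      (∀ (λs : Fin 4 → ℚ) → lin λs e ≡ 𝟘 → ∀ i → λs i ≡ 0ℚ)
    × (∀ y → (O y → ∃ λ (n : Fin 4 → ℤ) → y ≡ lin (λ i → ℤtoℚ (n i)) e)
           × ((∃ λ (n : Fin 4 → ℤ) → y ≡ lin (λ i → ℤtoℚ (n i)) e) → O y))

  record IsOrder (O : Subset) : Set where
    field
      has-one : O 𝟙
      +-closed : ∀ x y → O x → O y → O (x ⊕ y)
      neg-closed : ∀ x → O x → O (⊖ x)
      *-closed : ∀ x y → O x → O y → O (x ⊗ y)
      lattice : IsLattice4 O

  -- c S d, intended with d = c⁻¹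
  conjSet : Quat → Quat → Subset → Subset
  conjSet c d S y = ∃ λ x → S x × (y ≡ c ⊗ x ⊗ d)

  NonzeroWithInv : Quat → Quat → Set
  NonzeroWithInv c d = (c ≢ 𝟘) × (c ⊗ d ≡ 𝟙) × (d ⊗ c ≡ 𝟙)

  _ᵀ : Subset → Subset
  (O ᵀ) y = ∃ λ x → O x × (y ≡ (x ⊕ x) ⊕ ⊖ sc (Tr x))

  SameType : Subset → Subset → Set
  SameType O O' = ∃ λ c → ∃ λ d → NonzeroWithInv c d × (conjSet c d O ≐ O')

{-# OPTIONS --safe #-}
module Submission where

-- Conjugation by a unit c commutes with τ x = 2x − Tr x, so c O^T c⁻¹ = (c O c⁻¹)^T and orders
-- of the same type have conjugate O^T. Conversely, let (c O c⁻¹)^T = O'^T. Elements of an order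
-- have integral reduced trace and norm: the powers of an element stay in the lattice, so the
-- powers of its norm have bounded denominators. If x ∈ c O c⁻¹ and x' ∈ O' have τ x = τ x', then
-- x = x' + s with s ∈ ℚ, and both 2s = Tr x − Tr x' and s Tr x' + s² = Nrd x − Nrd x' are
-- integers; this forces s ∈ ℤ, hence x ∈ O'. Symmetrically O' ⊆ c O c⁻¹.

open import Defs
open import Algebra.Bundles using (CommutativeRing)
open import Data.Fin using (Fin; #_)
open import Data.Integer as ℤ using (ℤ; +_; -[1+_])
import Data.Integer.Properties as ℤP
import Data.Integer.Tactic.RingSolver as ℤ-Solver
open import Data.List using (List; []; _∷_; map; allFin; cartesianProduct)
open import Data.List.Membership.Propositional using (_∈_)
open import Data.List.Membership.Propositional.Properties using (∈-map⁺; ∈-cartesianProduct⁺; ∈-allFin)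
import Data.List.Relation.Unary.All as All
import Data.List.Relation.Unary.All.Properties as AllP
open import Data.Nat as ℕ using (ℕ; NonZero; zero; suc; _<_)
open import Data.Nat.Coprimality as Coprime using (Coprime; coprime-divisor)
open import Data.Nat.Divisibility using (_∣_; divides; ∣-trans; ∣⇒≤)
open import Data.Nat.ListAction using (product)
open import Data.Nat.ListAction.Properties using (∈⇒∣product; product≢0)
open import Data.Nat.Primality using (Prime)
import Data.Nat.Properties as ℕP
open import Data.Product using (_×_; ∃; ∃₂; _,_; proj₁; proj₂)
open import Data.Rational using (ℚ; 0ℚ; 1ℚ; _+_; _*_; -_; _-_; _/_; ↥_; ↧_; ↧ₙ_; mkℚ; toℚᵘ)
open import Data.Rational.Properties
  using (_≟_; +-*-commutativeRing; toℚᵘ-injective; toℚᵘ-fromℚᵘ; toℚᵘ-cong;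
         toℚᵘ-homo-+; toℚᵘ-homo-*; toℚᵘ-homo‿-; ↥p/↧p≡p; *-assoc; *-identityʳ; *-distribˡ-+)
open import Data.Rational.Unnormalised as ℚᵘ using (mkℚᵘ; *≡*) renaming (_≃_ to _≃ᵘ_)
import Data.Rational.Unnormalised.Properties as ℚᵘ
open import Data.Vec using (Vec; []; _∷_)
import Data.Vec as Vec
open import Function.Base using (_∘_)
open import Function.Bundles using (_⇔_; mk⇔)
open import Level using (0ℓ)
open import Relation.Binary.PropositionalEquality
open import Relation.Nullary using (contradiction)
open import Relation.Nullary.Decidable using (dec⇒maybe)
open import Relation.Unary using (_⊆_)
open import Tactic.RingSolver using (solve-∀)
open import Tactic.RingSolver.Core.AlmostCommutativeRing using (AlmostCommutativeRing; fromCommutativeRing)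

open import Algebra.Properties.CommutativeSemiring.Exp (CommutativeRing.commutativeSemiring +-*-commutativeRing)
  using (_^_; ^-distrib-*)

ℚ-ring : AlmostCommutativeRing 0ℓ 0ℓ
ℚ-ring = fromCommutativeRing +-*-commutativeRing (λ x → dec⇒maybe (0ℚ ≟ x))

open import Tactic.RingSolver.NonReflective ℚ-ring as ℚ-Solver using (Expr; Κ; Ι)
  renaming (_⊕_ to _+ᴱ_; _⊗_ to _*ᴱ_; ⊝_ to -ᴱ_)
open ℚ-Solver.Ops using (⟦_⟧; ⟦_⇓⟧; prove)

-- Integers and denominators in ℚ

fromℤ : ℤ → ℚ
fromℤ i = i / 1

toℚᵘ-fromℤ : ∀ i → toℚᵘ (fromℤ i) ≃ᵘ mkℚᵘ i 0
toℚᵘ-fromℤ i = toℚᵘ-fromℚᵘ (mkℚᵘ i 0)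

fromℤ-homo-+ : ∀ i j → fromℤ (i ℤ.+ j) ≡ fromℤ i + fromℤ j
fromℤ-homo-+ i j = toℚᵘ-injective (begin
  toℚᵘ (fromℤ (i ℤ.+ j))               ≈⟨ toℚᵘ-fromℤ (i ℤ.+ j) ⟩
  mkℚᵘ (i ℤ.+ j) 0                      ≈⟨ *≡* (cross-multiplied i j) ⟩
  mkℚᵘ i 0 ℚᵘ.+ mkℚᵘ j 0                ≈⟨ ℚᵘ.+-cong (toℚᵘ-fromℤ i) (toℚᵘ-fromℤ j) ⟨
  toℚᵘ (fromℤ i) ℚᵘ.+ toℚᵘ (fromℤ j)    ≈⟨ toℚᵘ-homo-+ (fromℤ i) (fromℤ j) ⟨
  toℚᵘ (fromℤ i + fromℤ j)              ∎)
  where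
  open ℚᵘ.≃-Reasoning
  cross-multiplied : ∀ i j → (i ℤ.+ j) ℤ.* (+ 1 ℤ.* + 1) ≡ (i ℤ.* + 1 ℤ.+ j ℤ.* + 1) ℤ.* + 1
  cross-multiplied = ℤ-Solver.solve-∀

fromℤ-homo-* : ∀ i j → fromℤ (i ℤ.* j) ≡ fromℤ i * fromℤ j
fromℤ-homo-* i j = toℚᵘ-injective (begin
  toℚᵘ (fromℤ (i ℤ.* j))               ≈⟨ toℚᵘ-fromℤ (i ℤ.* j) ⟩
  mkℚᵘ i 0 ℚᵘ.* mkℚᵘ j 0                ≈⟨ ℚᵘ.*-cong (toℚᵘ-fromℤ i) (toℚᵘ-fromℤ j) ⟨
  toℚᵘ (fromℤ i) ℚᵘ.* toℚᵘ (fromℤ j)    ≈⟨ toℚᵘ-homo-* (fromℤ i) (fromℤ j) ⟨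
  toℚᵘ (fromℤ i * fromℤ j)              ∎)
  where open ℚᵘ.≃-Reasoning

fromℤ-homo‿- : ∀ i → fromℤ (ℤ.- i) ≡ - fromℤ i
fromℤ-homo‿- i = toℚᵘ-injective (begin
  toℚᵘ (fromℤ (ℤ.- i))   ≈⟨ toℚᵘ-fromℤ (ℤ.- i) ⟩
  ℚᵘ.- mkℚᵘ i 0           ≈⟨ ℚᵘ.-‿cong (toℚᵘ-fromℤ i) ⟨
  ℚᵘ.- toℚᵘ (fromℤ i)     ≈⟨ toℚᵘ-homo‿- (fromℤ i) ⟨
  toℚᵘ (- fromℤ i)        ∎)
  where open ℚᵘ.≃-Reasoning

fromℤ-homo-^ : ∀ i k → fromℤ (i ℤ.^ k) ≡ fromℤ i ^ k
fromℤ-homo-^ i zero = refl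
fromℤ-homo-^ i (suc k) = trans (fromℤ-homo-* i (i ℤ.^ k)) (cong (fromℤ i *_) (fromℤ-homo-^ i k))

fromℤ-injective : ∀ {i j} → fromℤ i ≡ fromℤ j → i ≡ j
fromℤ-injective {i} {j} eq
  with ℚᵘ.≃-trans (ℚᵘ.≃-sym (toℚᵘ-fromℤ i)) (ℚᵘ.≃-trans (toℚᵘ-cong eq) (toℚᵘ-fromℤ j))
... | *≡* i*1≡j*1 = trans (sym (ℤP.*-identityʳ i)) (trans i*1≡j*1 (ℤP.*-identityʳ j))

p*↧p≡↥p : ∀ p → p * fromℤ (↧ p) ≡ fromℤ (↥ p)
p*↧p≡↥p p@(mkℚ u d _) = toℚᵘ-injective (begin
  toℚᵘ (p * fromℤ (↧ p))                ≈⟨ toℚᵘ-homo-* p (fromℤ (↧ p)) ⟩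
  toℚᵘ p ℚᵘ.* toℚᵘ (fromℤ (↧ p))        ≈⟨ ℚᵘ.*-congˡ {toℚᵘ p} (toℚᵘ-fromℤ (↧ p)) ⟩
  mkℚᵘ u d ℚᵘ.* mkℚᵘ (↧ p) 0            ≈⟨ *≡* cross-multiplied ⟩
  mkℚᵘ u 0                              ≈⟨ toℚᵘ-fromℤ u ⟨
  toℚᵘ (fromℤ (↥ p))                    ∎)
  where
  open ℚᵘ.≃-Reasoning
  cross-multiplied : u ℤ.* + suc d ℤ.* + 1 ≡ u ℤ.* + (suc d ℕ.* 1)
  cross-multiplied = trans (ℤP.*-identityʳ (u ℤ.* + suc d)) (cong (λ m → u ℤ.* + m) (sym (ℕP.*-identityʳ (suc d))))

abs-^ : ∀ i k → ℤ.∣ i ℤ.^ k ∣ ≡ ℤ.∣ i ∣ ℕ.^ k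
abs-^ i zero = refl
abs-^ i (suc k) = trans (ℤP.abs-* i (i ℤ.^ k)) (cong (ℤ.∣ i ∣ ℕ.*_) (abs-^ i k))

Integral : ℚ → Set
Integral q = ∃ λ i → q ≡ fromℤ i

integral-+ : ∀ {p q} → Integral p → Integral q → Integral (p + q)
integral-+ (i , refl) (j , refl) = i ℤ.+ j , sym (fromℤ-homo-+ i j)

integral-* : ∀ {p q} → Integral p → Integral q → Integral (p * q)
integral-* (i , refl) (j , refl) = i ℤ.* j , sym (fromℤ-homo-* i j)

integral-neg : ∀ {p} → Integral p → Integral (- p)
integral-neg (i , refl) = ℤ.- i , sym (fromℤ-homo‿- i)

integral-- : ∀ {p q} → Integral p → Integral q → Integral (p - q)
integral-- p∈ℤ q∈ℤ = integral-+ p∈ℤ (integral-neg q∈ℤ)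

integral-difference : ∀ {p q r} → p ≡ q + r → Integral p → Integral q → Integral r
integral-difference {q = q} {r} refl p∈ℤ q∈ℤ = subst Integral (cancel q r) (integral-- p∈ℤ q∈ℤ)
  where
  cancel : ∀ q r → q + r - q ≡ r
  cancel = solve-∀ ℚ-ring

record _clears_ (D : ℕ) (q : ℚ) : Set where
  constructor clearing
  field
    cleared : Integral (fromℤ (+ D) * q)

open _clears_

clears-+ : ∀ {D p q} → D clears p → D clears q → D clears (p + q)
clears-+ {D} {p} {q} (clearing Dp∈ℤ) (clearing Dq∈ℤ) = clearing
  (subst Integral (sym (*-distribˡ-+ (fromℤ (+ D)) p q)) (integral-+ Dp∈ℤ Dq∈ℤ))

clears-fromℤ* : ∀ {D q} i → D clears q → D clears (fromℤ i * q)
clears-fromℤ* {D} {q} i (clearing Dq∈ℤ) =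
  clearing (subst Integral (swap (fromℤ (+ D)) (fromℤ i) q) (integral-* (i , refl) Dq∈ℤ))
  where
  swap : ∀ d r q → r * (d * q) ≡ d * (r * q)
  swap = solve-∀ ℚ-ring

sum₄ : (Fin 4 → ℚ) → ℚ
sum₄ f = f (# 0) + f (# 1) + f (# 2) + f (# 3)

sum₄-clears : ∀ {D f} → (∀ i → D clears f i) → D clears sum₄ f
sum₄-clears D-clears =
  clears-+ (clears-+ (clears-+ (D-clears (# 0)) (D-clears (# 1))) (D-clears (# 2))) (D-clears (# 3))

denominator-divides⇒clears : ∀ {D q} → ↧ₙ q ∣ D → D clears q
denominator-divides⇒clears {q = q} (divides E refl) = clearing (+ E ℤ.* ↥ q , (begin
  fromℤ (+ (E ℕ.* ↧ₙ q)) * q          ≡⟨ cong (λ i → fromℤ i * q) (ℤP.pos-* E (↧ₙ q)) ⟩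
  fromℤ (+ E ℤ.* ↧ q) * q             ≡⟨ cong (_* q) (fromℤ-homo-* (+ E) (↧ q)) ⟩
  fromℤ (+ E) * fromℤ (↧ q) * q       ≡⟨ rearrange (fromℤ (+ E)) (fromℤ (↧ q)) q ⟩
  fromℤ (+ E) * (q * fromℤ (↧ q))     ≡⟨ cong (fromℤ (+ E) *_) (p*↧p≡↥p q) ⟩
  fromℤ (+ E) * fromℤ (↥ q)           ≡⟨ fromℤ-homo-* (+ E) (↥ q) ⟨
  fromℤ (+ E ℤ.* ↥ q)                 ∎))
  where
  open ≡-Reasoning
  rearrange : ∀ e d q → e * d * q ≡ e * (q * d)
  rearrange = solve-∀ ℚ-ring

-- Opaque because conversion checks would otherwise normalise the product, and ℕ multiplication
-- duplicates its second argument at every factor.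
opaque
  commonDenominator : List ℚ → ℕ
  commonDenominator qs = product (map ↧ₙ_ qs)

  instance
    commonDenominator-nonZero : ∀ {qs} → NonZero (commonDenominator qs)
    commonDenominator-nonZero {qs} = product≢0 (AllP.map⁺ (All.universal (λ _ → _) qs))

  commonDenominator-clears : ∀ {q qs} → q ∈ qs → commonDenominator qs clears q
  commonDenominator-clears q∈qs = denominator-divides⇒clears (∈⇒∣product (∈-map⁺ ↧ₙ_ q∈qs))

-- Rationals integral over ℤ

coprime-* : ∀ {m n o} → Coprime m n → Coprime m o → Coprime m (n ℕ.* o)
coprime-* m⊥n m⊥o (d∣m , d∣no) =
  m⊥o (d∣m , coprime-divisor (λ (e∣d , e∣n) → m⊥n (∣-trans e∣d d∣m , e∣n)) d∣no)

coprime-^ : ∀ {m n} → Coprime m n → ∀ k → Coprime m (n ℕ.^ k)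
coprime-^ m⊥n zero = Coprime.sym (Coprime.1-coprimeTo _)
coprime-^ m⊥n (suc k) = coprime-* m⊥n (coprime-^ m⊥n k)

n<m^n : ∀ {m} → 1 < m → ∀ n → n < m ℕ.^ n
n<m^n 1<m zero = ℕ.s≤s ℕ.z≤n
n<m^n {m@(suc _)} 1<m (suc n) = ℕP.≤-<-trans (n<m^n 1<m n)
  (subst (ℕ._< m ℕ.* m ℕ.^ n) (ℕP.*-identityˡ (m ℕ.^ n)) (ℕP.*-monoˡ-< (m ℕ.^ n) {{ℕP.m^n≢0 m n}} 1<m))

-- Writing q = u/v in lowest terms, D qᴰ ∈ ℤ gives vᴰ ∣ D uᴰ, hence vᴰ ∣ D, forcing v = 1.
cleared-powers⇒integral : ∀ D .{{_ : NonZero D}} q → (∀ k → D clears (q ^ k)) → Integral q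
cleared-powers⇒integral D q@(mkℚ u zero _) _ = u , sym (↥p/↧p≡p q)
cleared-powers⇒integral D q@(mkℚ u (suc e) u⊥v) D-clears =
  contradiction (∣⇒≤ vᴰ∣D) (ℕP.<⇒≱ (n<m^n (ℕ.s≤s (ℕ.s≤s ℕ.z≤n)) D))
  where
  v = ↧ₙ q
  m = proj₁ (cleared (D-clears D))

  in-ℤ : + D ℤ.* u ℤ.^ D ≡ m ℤ.* ↧ q ℤ.^ D
  in-ℤ = fromℤ-injective (begin
    fromℤ (+ D ℤ.* u ℤ.^ D)                ≡⟨ fromℤ-homo-* (+ D) (u ℤ.^ D) ⟩
    fromℤ (+ D) * fromℤ (u ℤ.^ D)          ≡⟨ cong (fromℤ (+ D) *_) (fromℤ-homo-^ u D) ⟩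
    fromℤ (+ D) * fromℤ u ^ D              ≡⟨ cong (λ r → fromℤ (+ D) * r ^ D) (p*↧p≡↥p q) ⟨
    fromℤ (+ D) * (q * fromℤ (↧ q)) ^ D    ≡⟨ cong (fromℤ (+ D) *_) (^-distrib-* q (fromℤ (↧ q)) D) ⟩
    fromℤ (+ D) * (q ^ D * fromℤ (↧ q) ^ D) ≡⟨ *-assoc (fromℤ (+ D)) (q ^ D) _ ⟨
    fromℤ (+ D) * q ^ D * fromℤ (↧ q) ^ D   ≡⟨ cong (_* fromℤ (↧ q) ^ D) (proj₂ (cleared (D-clears D))) ⟩
    fromℤ m * fromℤ (↧ q) ^ D              ≡⟨ cong (fromℤ m *_) (fromℤ-homo-^ (↧ q) D) ⟨
    fromℤ m * fromℤ (↧ q ℤ.^ D)            ≡⟨ fromℤ-homo-* m (↧ q ℤ.^ D) ⟨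
    fromℤ (m ℤ.* ↧ q ℤ.^ D)                ∎)
    where open ≡-Reasoning

  in-ℕ : ℤ.∣ u ∣ ℕ.^ D ℕ.* D ≡ ℤ.∣ m ∣ ℕ.* v ℕ.^ D
  in-ℕ = begin
    ℤ.∣ u ∣ ℕ.^ D ℕ.* D             ≡⟨ ℕP.*-comm (ℤ.∣ u ∣ ℕ.^ D) D ⟩
    D ℕ.* ℤ.∣ u ∣ ℕ.^ D             ≡⟨ cong (D ℕ.*_) (abs-^ u D) ⟨
    D ℕ.* ℤ.∣ u ℤ.^ D ∣             ≡⟨ ℤP.abs-* (+ D) (u ℤ.^ D) ⟨
    ℤ.∣ + D ℤ.* u ℤ.^ D ∣           ≡⟨ cong ℤ.∣_∣ in-ℤ ⟩
    ℤ.∣ m ℤ.* ↧ q ℤ.^ D ∣           ≡⟨ ℤP.abs-* m (↧ q ℤ.^ D) ⟩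
    ℤ.∣ m ∣ ℕ.* ℤ.∣ ↧ q ℤ.^ D ∣     ≡⟨ cong (ℤ.∣ m ∣ ℕ.*_) (abs-^ (↧ q) D) ⟩
    ℤ.∣ m ∣ ℕ.* v ℕ.^ D             ∎
    where open ≡-Reasoning

  vᴰ∣D : v ℕ.^ D ∣ D
  vᴰ∣D = coprime-divisor (coprime-^ (Coprime.sym (coprime-^ (Coprime.recompute u⊥v) D)) D) (divides ℤ.∣ m ∣ in-ℕ)

-- A root s of X² + tX − m with t, m ∈ ℤ and 2s ∈ ℤ: its powers lie in ℤ + ℤs, so 2 clears them.
quadratic-root-integral : ∀ {s t} → Integral t → Integral (s + s) → Integral (s * t + s * s) → Integral s
quadratic-root-integral {s} {t} t∈ℤ 2s∈ℤ m∈ℤ = cleared-powers⇒integral 2 s (λ k → 2-clears (powers k))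
  where
  InSpan : ℚ → Set
  InSpan q = ∃₂ λ α β → Integral α × Integral β × q ≡ α + β * s

  powers : ∀ k → InSpan (s ^ k)
  powers zero = 1ℚ , 0ℚ , (+ 1 , refl) , (+ 0 , refl) , unit s
    where
    unit : ∀ s → 1ℚ ≡ 1ℚ + 0ℚ * s
    unit = solve-∀ ℚ-ring
  powers (suc k) with powers k
  ... | α , β , α∈ℤ , β∈ℤ , sᵏ≡α+βs =
    β * (s * t + s * s) , α - β * t , integral-* β∈ℤ m∈ℤ , integral-- α∈ℤ (integral-* β∈ℤ t∈ℤ) ,
    trans (cong (s *_) sᵏ≡α+βs) (reduce α β s t)
    where
    reduce : ∀ α β s t → s * (α + β * s) ≡ β * (s * t + s * s) + (α - β * t) * s
    reduce = solve-∀ ℚ-ring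

  2-clears : ∀ {q} → InSpan q → 2 clears q
  2-clears (α , β , α∈ℤ , β∈ℤ , refl) =
    clearing (subst Integral (regroup α β s) (integral-+ (integral-* (+ 2 , refl) α∈ℤ) (integral-* β∈ℤ 2s∈ℤ)))
    where
    regroup : ∀ α β s → fromℤ (+ 2) * α + β * (s + s) ≡ fromℤ (+ 2) * (α + β * s)
    regroup = solve-∀ ℚ-ring

-- Quaternion identities, by normalising coordinates

quat-cong : ∀ {x₀ x₁ x₂ x₃ y₀ y₁ y₂ y₃} → x₀ ≡ y₀ → x₁ ≡ y₁ → x₂ ≡ y₂ → x₃ ≡ y₃ →
            quat x₀ x₁ x₂ x₃ ≡ quat y₀ y₁ y₂ y₃
quat-cong refl refl refl refl = refl

-- Quaternions whose coordinates are polynomials in 26 variables: the structure constants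
-- a and b, four scalars, and the coordinates of five quaternions. The operations copy those
-- of QuatAlg symbol for symbol, so evaluating an expression gives the QuatAlg expression
-- definitionally, and an identity between quaternions follows by normalising coordinates.
record Quatᴱ : Set where
  constructor quatᴱ
  field
    e₀ e₁ e₂ e₃ : Expr ℚ 26

infixl 6 _-ᴱ_ _⊕ᴱ_
infixl 7 _⊗ᴱ_

_-ᴱ_ : Expr ℚ 26 → Expr ℚ 26 → Expr ℚ 26
p -ᴱ q = p +ᴱ -ᴱ q

Aᴱ Bᴱ S₀ S₁ S₂ S₃ : Expr ℚ 26
Aᴱ = Ι (# 0)
Bᴱ = Ι (# 1)
S₀ = Ι (# 2)
S₁ = Ι (# 3)
S₂ = Ι (# 4)
S₃ = Ι (# 5)

X₀ X₁ X₂ X₃ X₄ : Quatᴱ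
X₀ = quatᴱ (Ι (# 6)) (Ι (# 7)) (Ι (# 8)) (Ι (# 9))
X₁ = quatᴱ (Ι (# 10)) (Ι (# 11)) (Ι (# 12)) (Ι (# 13))
X₂ = quatᴱ (Ι (# 14)) (Ι (# 15)) (Ι (# 16)) (Ι (# 17))
X₃ = quatᴱ (Ι (# 18)) (Ι (# 19)) (Ι (# 20)) (Ι (# 21))
X₄ = quatᴱ (Ι (# 22)) (Ι (# 23)) (Ι (# 24)) (Ι (# 25))

_⊕ᴱ_ : Quatᴱ → Quatᴱ → Quatᴱ
quatᴱ x₀ x₁ x₂ x₃ ⊕ᴱ quatᴱ y₀ y₁ y₂ y₃ = quatᴱ (x₀ +ᴱ y₀) (x₁ +ᴱ y₁) (x₂ +ᴱ y₂) (x₃ +ᴱ y₃)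

⊖ᴱ_ : Quatᴱ → Quatᴱ
⊖ᴱ quatᴱ x₀ x₁ x₂ x₃ = quatᴱ (-ᴱ x₀) (-ᴱ x₁) (-ᴱ x₂) (-ᴱ x₃)

_⊗ᴱ_ : Quatᴱ → Quatᴱ → Quatᴱ
quatᴱ x₀ x₁ x₂ x₃ ⊗ᴱ quatᴱ y₀ y₁ y₂ y₃ = quatᴱ
  (x₀ *ᴱ y₀ +ᴱ Aᴱ *ᴱ (x₁ *ᴱ y₁) +ᴱ Bᴱ *ᴱ (x₂ *ᴱ y₂) -ᴱ (Aᴱ *ᴱ Bᴱ) *ᴱ (x₃ *ᴱ y₃))
  (x₀ *ᴱ y₁ +ᴱ x₁ *ᴱ y₀ -ᴱ Bᴱ *ᴱ (x₂ *ᴱ y₃) +ᴱ Bᴱ *ᴱ (x₃ *ᴱ y₂))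
  (x₀ *ᴱ y₂ +ᴱ x₂ *ᴱ y₀ +ᴱ Aᴱ *ᴱ (x₁ *ᴱ y₃) -ᴱ Aᴱ *ᴱ (x₃ *ᴱ y₁))
  (x₀ *ᴱ y₃ +ᴱ x₃ *ᴱ y₀ +ᴱ x₁ *ᴱ y₂ -ᴱ x₂ *ᴱ y₁)

scᴱ : Expr ℚ 26 → Quatᴱ
scᴱ r = quatᴱ r (Κ 0ℚ) (Κ 0ℚ) (Κ 0ℚ)

𝟙ᴱ : Quatᴱ
𝟙ᴱ = scᴱ (Κ 1ℚ)

_·ᴱ_ : Expr ℚ 26 → Quatᴱ → Quatᴱ
r ·ᴱ quatᴱ x₀ x₁ x₂ x₃ = quatᴱ (r *ᴱ x₀) (r *ᴱ x₁) (r *ᴱ x₂) (r *ᴱ x₃)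

Trᴱ : Quatᴱ → Expr ℚ 26
Trᴱ (quatᴱ x₀ _ _ _) = x₀ +ᴱ x₀

⟪_,_⟫ᴱ : Quatᴱ → Quatᴱ → Expr ℚ 26
⟪ quatᴱ x₀ x₁ x₂ x₃ , quatᴱ y₀ y₁ y₂ y₃ ⟫ᴱ =
  x₀ *ᴱ y₀ -ᴱ Aᴱ *ᴱ (x₁ *ᴱ y₁) -ᴱ Bᴱ *ᴱ (x₂ *ᴱ y₂) +ᴱ Aᴱ *ᴱ Bᴱ *ᴱ (x₃ *ᴱ y₃)

Nrdᴱ : Quatᴱ → Expr ℚ 26
Nrdᴱ x = ⟪ x , x ⟫ᴱ

⟦_⟧ᴴ : Quatᴱ → Vec ℚ 26 → Quat
⟦ quatᴱ x₀ x₁ x₂ x₃ ⟧ᴴ ρ = quat (⟦ x₀ ⟧ ρ) (⟦ x₁ ⟧ ρ) (⟦ x₂ ⟧ ρ) (⟦ x₃ ⟧ ρ)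

proveᴴ : ∀ ρ P Q → let open Quatᴱ in
         ⟦ e₀ P ⇓⟧ ρ ≡ ⟦ e₀ Q ⇓⟧ ρ → ⟦ e₁ P ⇓⟧ ρ ≡ ⟦ e₁ Q ⇓⟧ ρ →
         ⟦ e₂ P ⇓⟧ ρ ≡ ⟦ e₂ Q ⇓⟧ ρ → ⟦ e₃ P ⇓⟧ ρ ≡ ⟦ e₃ Q ⇓⟧ ρ → ⟦ P ⟧ᴴ ρ ≡ ⟦ Q ⟧ᴴ ρ
proveᴴ ρ (quatᴱ p₀ p₁ p₂ p₃) (quatᴱ q₀ q₁ q₂ q₃) h₀ h₁ h₂ h₃ =
  quat-cong (prove ρ p₀ q₀ h₀) (prove ρ p₁ q₁ h₁) (prove ρ p₂ q₂ h₂) (prove ρ p₃ q₃ h₃)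

pad : ∀ {A : Set} n → A → List A → Vec A n
pad zero    _ _        = []
pad (suc n) d []       = d ∷ pad n d []
pad (suc n) d (x ∷ xs) = x ∷ pad n d xs

module QuaternionAlgebra (a b : ℚ) where
  open QuatAlg a b

  coordinates : Quat → Vec ℚ 4
  coordinates (quat x₀ x₁ x₂ x₃) = x₀ ∷ x₁ ∷ x₂ ∷ x₃ ∷ []

  -- Values of the variables of Quatᴱ; the scalars and quaternions not listed are 0.
  env : List ℚ → List Quat → Vec ℚ 26
  env ss xs = a ∷ b ∷ pad 4 0ℚ ss Vec.++ Vec.concat (Vec.map coordinates (pad 5 𝟘 xs))

  ⟪_,_⟫ : Quat → Quat → ℚ
  ⟪ quat x₀ x₁ x₂ x₃ , quat y₀ y₁ y₂ y₃ ⟫ = x₀ * y₀ - a * (x₁ * y₁) - b * (x₂ * y₂) + a * b * (x₃ * y₃)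

  Nrd : Quat → ℚ
  Nrd x = ⟪ x , x ⟫

  ⟪⟫-sym : ∀ x y → ⟪ x , y ⟫ ≡ ⟪ y , x ⟫
  ⟪⟫-sym x y = prove (env [] (x ∷ y ∷ [])) ⟪ X₀ , X₁ ⟫ᴱ ⟪ X₁ , X₀ ⟫ᴱ refl

  ⟪⟫-lin : ∀ r e z → ⟪ lin r e , z ⟫ ≡ sum₄ (λ i → r i * ⟪ e i , z ⟫)
  ⟪⟫-lin r e z = prove (env (r (# 0) ∷ r (# 1) ∷ r (# 2) ∷ r (# 3) ∷ []) (e (# 0) ∷ e (# 1) ∷ e (# 2) ∷ e (# 3) ∷ z ∷ []))
    ⟪ S₀ ·ᴱ X₀ ⊕ᴱ S₁ ·ᴱ X₁ ⊕ᴱ S₂ ·ᴱ X₂ ⊕ᴱ S₃ ·ᴱ X₃ , X₄ ⟫ᴱ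
    (S₀ *ᴱ ⟪ X₀ , X₄ ⟫ᴱ +ᴱ S₁ *ᴱ ⟪ X₁ , X₄ ⟫ᴱ +ᴱ S₂ *ᴱ ⟪ X₂ , X₄ ⟫ᴱ +ᴱ S₃ *ᴱ ⟪ X₃ , X₄ ⟫ᴱ) refl

  Nrd-* : ∀ x y → Nrd (x ⊗ y) ≡ Nrd x * Nrd y
  Nrd-* x y = prove (env [] (x ∷ y ∷ [])) (Nrdᴱ (X₀ ⊗ᴱ X₁)) (Nrdᴱ X₀ *ᴱ Nrdᴱ X₁) refl

  Nrd-𝟙 : Nrd 𝟙 ≡ 1ℚ
  Nrd-𝟙 = prove (env [] []) (Nrdᴱ 𝟙ᴱ) (Κ 1ℚ) refl

  Nrd-+sc : ∀ x s → Nrd (x ⊕ sc s) ≡ Nrd x + (s * Tr x + s * s)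
  Nrd-+sc x s = prove (env (s ∷ []) (x ∷ [])) (Nrdᴱ (X₀ ⊕ᴱ scᴱ S₀)) (Nrdᴱ X₀ +ᴱ (S₀ *ᴱ Trᴱ X₀ +ᴱ S₀ *ᴱ S₀)) refl

  τ : Quat → Quat
  τ x = (x ⊕ x) ⊕ ⊖ sc (Tr x)

  Tr-+sc : ∀ x s → Tr (x ⊕ sc s) ≡ Tr x + (s + s)
  Tr-+sc x s = prove (env (s ∷ []) (x ∷ [])) (Trᴱ (X₀ ⊕ᴱ scᴱ S₀)) (Trᴱ X₀ +ᴱ (S₀ +ᴱ S₀)) refl

  Tr-rotate : ∀ c x d → Tr (c ⊗ x ⊗ d) ≡ Tr (d ⊗ c ⊗ x)
  Tr-rotate c x d = prove (env [] (c ∷ x ∷ d ∷ [])) (Trᴱ (X₀ ⊗ᴱ X₁ ⊗ᴱ X₂)) (Trᴱ (X₂ ⊗ᴱ X₀ ⊗ᴱ X₁)) refl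

  Tr-𝟙⊗ : ∀ x → Tr (𝟙 ⊗ x) ≡ Tr x
  Tr-𝟙⊗ x = prove (env [] (x ∷ [])) (Trᴱ (𝟙ᴱ ⊗ᴱ X₀)) (Trᴱ X₀) refl

  ·𝟙 : ∀ s → s · 𝟙 ≡ sc s
  ·𝟙 s = proveᴴ (env (s ∷ []) []) (S₀ ·ᴱ 𝟙ᴱ) (scᴱ S₀) refl refl refl refl

  ⊗-+sc-⊗ : ∀ c x d s → c ⊗ (x ⊕ sc s) ⊗ d ≡ c ⊗ x ⊗ d ⊕ s · (c ⊗ d)
  ⊗-+sc-⊗ c x d s = proveᴴ (env (s ∷ []) (c ∷ x ∷ d ∷ []))
    (X₀ ⊗ᴱ (X₁ ⊕ᴱ scᴱ S₀) ⊗ᴱ X₂) (X₀ ⊗ᴱ X₁ ⊗ᴱ X₂ ⊕ᴱ S₀ ·ᴱ (X₀ ⊗ᴱ X₂)) refl refl refl refl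

  ⊗-τ-⊗ : ∀ c x d t → c ⊗ ((x ⊕ x) ⊕ ⊖ sc t) ⊗ d ≡ (c ⊗ x ⊗ d ⊕ c ⊗ x ⊗ d) ⊕ ⊖ (t · (c ⊗ d))
  ⊗-τ-⊗ c x d t = proveᴴ (env (t ∷ []) (c ∷ x ∷ d ∷ []))
    (X₀ ⊗ᴱ ((X₁ ⊕ᴱ X₁) ⊕ᴱ ⊖ᴱ scᴱ S₀) ⊗ᴱ X₂) ((X₀ ⊗ᴱ X₁ ⊗ᴱ X₂ ⊕ᴱ X₀ ⊗ᴱ X₁ ⊗ᴱ X₂) ⊕ᴱ ⊖ᴱ (S₀ ·ᴱ (X₀ ⊗ᴱ X₂)))
    refl refl refl refl

  τ≡τ⇒≡+sc : ∀ y x → τ y ≡ τ x → y ≡ x ⊕ sc (Quat.c0 y - Quat.c0 x)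
  τ≡τ⇒≡+sc (quat y₀ y₁ y₂ y₃) (quat x₀ x₁ x₂ x₃) τy≡τx =
    quat-cong (shift y₀ x₀) (halve y₁ x₁ (cong Quat.c1 τy≡τx)) (halve y₂ x₂ (cong Quat.c2 τy≡τx))
              (halve y₃ x₃ (cong Quat.c3 τy≡τx))
    where
    shift : ∀ u v → u ≡ v + (u - v)
    shift = solve-∀ ℚ-ring
    halve : ∀ u v → u + u + - 0ℚ ≡ v + v + - 0ℚ → u ≡ v + 0ℚ
    halve u v eq = begin
      u                   ≡⟨ half u ⟩
      ½ * (u + u + - 0ℚ)  ≡⟨ cong (½ *_) eq ⟩
      ½ * (v + v + - 0ℚ)  ≡⟨ half′ v ⟩
      v + 0ℚ              ∎
      where
      open ≡-Reasoning
      ½ : ℚ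
      ½ = + 1 / 2
      half : ∀ u → u ≡ ½ * (u + u + - 0ℚ)
      half = solve-∀ ℚ-ring
      half′ : ∀ v → ½ * (v + v + - 0ℚ) ≡ v + 0ℚ
      half′ = solve-∀ ℚ-ring

  infixr 8 _⊗^_
  _⊗^_ : Quat → ℕ → Quat
  x ⊗^ zero = 𝟙
  x ⊗^ suc k = x ⊗ x ⊗^ k

  Nrd-⊗^ : ∀ x k → Nrd (x ⊗^ k) ≡ Nrd x ^ k
  Nrd-⊗^ x zero = Nrd-𝟙
  Nrd-⊗^ x (suc k) = trans (Nrd-* x (x ⊗^ k)) (cong (Nrd x *_) (Nrd-⊗^ x k))

  module _ (c d : Quat) where

    Tr-conj : d ⊗ c ≡ 𝟙 → ∀ x → Tr (c ⊗ x ⊗ d) ≡ Tr x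
    Tr-conj dc≡𝟙 x = begin
      Tr (c ⊗ x ⊗ d)  ≡⟨ Tr-rotate c x d ⟩
      Tr (d ⊗ c ⊗ x)  ≡⟨ cong (λ u → Tr (u ⊗ x)) dc≡𝟙 ⟩
      Tr (𝟙 ⊗ x)      ≡⟨ Tr-𝟙⊗ x ⟩
      Tr x            ∎
      where open ≡-Reasoning

    Nrd-conj : c ⊗ d ≡ 𝟙 → ∀ x → Nrd (c ⊗ x ⊗ d) ≡ Nrd x
    Nrd-conj cd≡𝟙 x = begin
      Nrd (c ⊗ x ⊗ d)          ≡⟨ Nrd-* (c ⊗ x) d ⟩
      Nrd (c ⊗ x) * Nrd d      ≡⟨ cong (_* Nrd d) (Nrd-* c x) ⟩
      Nrd c * Nrd x * Nrd d    ≡⟨ rearrange (Nrd c) (Nrd x) (Nrd d) ⟩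
      Nrd x * (Nrd c * Nrd d)  ≡⟨ cong (Nrd x *_) (Nrd-* c d) ⟨
      Nrd x * Nrd (c ⊗ d)      ≡⟨ cong (λ u → Nrd x * Nrd u) cd≡𝟙 ⟩
      Nrd x * Nrd 𝟙            ≡⟨ cong (Nrd x *_) Nrd-𝟙 ⟩
      Nrd x * 1ℚ               ≡⟨ *-identityʳ (Nrd x) ⟩
      Nrd x                    ∎
      where
      open ≡-Reasoning
      rearrange : ∀ p q r → p * q * r ≡ q * (p * r)
      rearrange = solve-∀ ℚ-ring

    conj-+sc : c ⊗ d ≡ 𝟙 → ∀ x s → c ⊗ (x ⊕ sc s) ⊗ d ≡ c ⊗ x ⊗ d ⊕ sc s
    conj-+sc cd≡𝟙 x s = begin
      c ⊗ (x ⊕ sc s) ⊗ d       ≡⟨ ⊗-+sc-⊗ c x d s ⟩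
      c ⊗ x ⊗ d ⊕ s · (c ⊗ d)  ≡⟨ cong (λ u → c ⊗ x ⊗ d ⊕ s · u) cd≡𝟙 ⟩
      c ⊗ x ⊗ d ⊕ s · 𝟙        ≡⟨ cong (c ⊗ x ⊗ d ⊕_) (·𝟙 s) ⟩
      c ⊗ x ⊗ d ⊕ sc s         ∎
      where open ≡-Reasoning

    conj-τ : c ⊗ d ≡ 𝟙 → d ⊗ c ≡ 𝟙 → ∀ x → c ⊗ τ x ⊗ d ≡ τ (c ⊗ x ⊗ d)
    conj-τ cd≡𝟙 dc≡𝟙 x = begin
      c ⊗ τ x ⊗ d                    ≡⟨ ⊗-τ-⊗ c x d (Tr x) ⟩
      (y ⊕ y) ⊕ ⊖ (Tr x · (c ⊗ d))   ≡⟨ cong (λ u → (y ⊕ y) ⊕ ⊖ (Tr x · u)) cd≡𝟙 ⟩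
      (y ⊕ y) ⊕ ⊖ (Tr x · 𝟙)         ≡⟨ cong (λ u → (y ⊕ y) ⊕ ⊖ u) (·𝟙 (Tr x)) ⟩
      (y ⊕ y) ⊕ ⊖ sc (Tr x)          ≡⟨ cong (λ t → (y ⊕ y) ⊕ ⊖ sc t) (Tr-conj dc≡𝟙 x) ⟨
      τ y                            ∎
      where
      open ≡-Reasoning
      y = c ⊗ x ⊗ d

  TraceNormIntegral : Subset → Set
  TraceNormIntegral S = ∀ {x} → S x → Integral (Tr x) × Integral (Nrd x)

  TranslationClosed : Subset → Set
  TranslationClosed S = ∀ {x} i → S x → S (x ⊕ sc (fromℤ i))

  conj-translationClosed : ∀ c d {S} → c ⊗ d ≡ 𝟙 → TranslationClosed S → TranslationClosed (conjSet c d S)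
  conj-translationClosed c d cd≡𝟙 S-closed i (x , x∈S , refl) =
    x ⊕ sc (fromℤ i) , S-closed i x∈S , sym (conj-+sc c d cd≡𝟙 x (fromℤ i))

  module _ (c d : Quat) (cd≡𝟙 : c ⊗ d ≡ 𝟙) (dc≡𝟙 : d ⊗ c ≡ 𝟙) {S : Subset} where

    conj-traceNormIntegral : TraceNormIntegral S → TraceNormIntegral (conjSet c d S)
    conj-traceNormIntegral S-integral (x , x∈S , refl) =
      subst Integral (sym (Tr-conj c d dc≡𝟙 x)) (proj₁ (S-integral x∈S)) ,
      subst Integral (sym (Nrd-conj c d cd≡𝟙 x)) (proj₂ (S-integral x∈S))

    conj-ᵀ : conjSet c d (S ᵀ) ≐ (conjSet c d S ᵀ)
    conj-ᵀ y = (λ { (_ , (x , x∈S , refl) , refl) → c ⊗ x ⊗ d , (x , x∈S , refl) , conj-τ c d cd≡𝟙 dc≡𝟙 x })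
             , (λ { (_ , (x , x∈S , refl) , refl) → τ x , (x , x∈S , refl) , sym (conj-τ c d cd≡𝟙 dc≡𝟙 x) })

  ≐⇒⊆ : ∀ {S T} → S ≐ T → S ⊆ T
  ≐⇒⊆ S≐T {y} = proj₁ (S≐T y)

  ≐⇒⊇ : ∀ {S T} → S ≐ T → T ⊆ S
  ≐⇒⊇ S≐T {y} = proj₂ (S≐T y)

  ⊆⇒≐ : ∀ {S T} → S ⊆ T → T ⊆ S → S ≐ T
  ⊆⇒≐ S⊆T T⊆S y = S⊆T , T⊆S

  ᵀ-mono : ∀ {S T} → S ⊆ T → S ᵀ ⊆ T ᵀ
  ᵀ-mono S⊆T (x , x∈S , refl) = x , S⊆T x∈S , refl

  -- If τ x = τ x' then x = x' + s with s ∈ ℚ, and integrality of the traces and norms of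
  -- x and x' makes s a root of X² + Tr(x') X − (Nrd x − Nrd x') with 2s ∈ ℤ.
  ᵀ-reflects-⊆ : ∀ {S T} → TraceNormIntegral S → TraceNormIntegral T → TranslationClosed T →
                 S ᵀ ⊆ T ᵀ → S ⊆ T
  ᵀ-reflects-⊆ {S} {T} S-integral T-integral T-closed Sᵀ⊆Tᵀ {x} x∈S
    with Sᵀ⊆Tᵀ (x , x∈S , refl)
  ... | x' , x'∈T , τx≡τx' =
    subst T (sym (trans x≡x'+s (cong (λ u → x' ⊕ sc u) (proj₂ s∈ℤ)))) (T-closed (proj₁ s∈ℤ) x'∈T)
    where
    s = Quat.c0 x - Quat.c0 x'
    x≡x'+s : x ≡ x' ⊕ sc s
    x≡x'+s = τ≡τ⇒≡+sc x x' τx≡τx'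
    s∈ℤ : Integral s
    s∈ℤ = quadratic-root-integral (proj₁ (T-integral x'∈T))
      (integral-difference (trans (cong Tr x≡x'+s) (Tr-+sc x' s)) (proj₁ (S-integral x∈S)) (proj₁ (T-integral x'∈T)))
      (integral-difference (trans (cong Nrd x≡x'+s) (Nrd-+sc x' s)) (proj₂ (S-integral x∈S)) (proj₂ (T-integral x'∈T)))

  module Order {O : Subset} (O-order : IsOrder O) where
    open IsOrder O-order

    fromℕ-closed : ∀ n → O (sc (fromℤ (+ n)))
    fromℕ-closed zero = +-closed 𝟙 (⊖ 𝟙) has-one (neg-closed 𝟙 has-one)
    fromℕ-closed (suc n) =
      subst O (cong sc (sym (fromℤ-homo-+ (+ 1) (+ n)))) (+-closed 𝟙 _ has-one (fromℕ-closed n))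

    fromℤ-closed : ∀ i → O (sc (fromℤ i))
    fromℤ-closed (+ n) = fromℕ-closed n
    fromℤ-closed -[1+ n ] =
      subst O (cong sc (sym (fromℤ-homo‿- (+ suc n)))) (neg-closed _ (fromℕ-closed (suc n)))

    translationClosed : TranslationClosed O
    translationClosed i x∈O = +-closed _ _ x∈O (fromℤ-closed i)

    ⊗^-closed : ∀ {x} k → O x → O (x ⊗^ k)
    ⊗^-closed zero x∈O = has-one
    ⊗^-closed (suc k) x∈O = *-closed _ _ x∈O (⊗^-closed k x∈O)

    basis : Fin 4 → Quat
    basis = proj₁ lattice

    spanned : ∀ {y} → O y → ∃ λ n → y ≡ lin (fromℤ ∘ n) basis
    spanned {y} = proj₁ (proj₂ (proj₂ lattice) y)

    gramEntry : Fin 4 × Fin 4 → ℚ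
    gramEntry (i , j) = ⟪ basis i , basis j ⟫

    gram : List ℚ
    gram = map gramEntry (cartesianProduct (allFin 4) (allFin 4))

    D : ℕ
    D = commonDenominator gram

    gram-cleared : ∀ i j → D clears ⟪ basis i , basis j ⟫
    gram-cleared i j = commonDenominator-clears {qs = gram} (∈-map⁺ gramEntry (∈-cartesianProduct⁺ (∈-allFin i) (∈-allFin j)))

    spanned-cleared : ∀ {y z} → (∀ i → D clears ⟪ basis i , z ⟫) → O y → D clears ⟪ y , z ⟫
    spanned-cleared {z = z} basis-cleared y∈O with spanned y∈O
    ... | n , refl = subst (D clears_) (sym (⟪⟫-lin (fromℤ ∘ n) basis z))
                       (sum₄-clears (λ i → clears-fromℤ* (n i) (basis-cleared i)))

    form-cleared : ∀ {y z} → O y → O z → D clears ⟪ y , z ⟫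
    form-cleared {z = z} y∈O z∈O = spanned-cleared
      (λ i → subst (D clears_) (⟪⟫-sym z (basis i)) (spanned-cleared (λ j → gram-cleared j i) z∈O)) y∈O

    Nrd-integral : ∀ {y} → O y → Integral (Nrd y)
    Nrd-integral {y} y∈O = cleared-powers⇒integral D (Nrd y) λ k →
      subst (D clears_) (Nrd-⊗^ y k) (form-cleared (⊗^-closed k y∈O) (⊗^-closed k y∈O))

    Tr-integral : ∀ {y} → O y → Integral (Tr y)
    Tr-integral {y} y∈O = subst Integral (cancel (Tr y))
      (integral-- (integral-difference (Nrd-+sc y 1ℚ) (Nrd-integral (translationClosed (+ 1) y∈O)) (Nrd-integral y∈O))
                  (+ 1 , refl))
      where
      cancel : ∀ t → 1ℚ * t + 1ℚ * 1ℚ - 1ℚ ≡ t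
      cancel = solve-∀ ℚ-ring

    traceNormIntegral : TraceNormIntegral O
    traceNormIntegral x∈O = Tr-integral x∈O , Nrd-integral x∈O

lemma3p6 : (p : ℕ) → Prime p → (a b : ℚ) → BpParams p a b →
    let open QuatAlg a b in
    (O O' : Subset) → IsOrder O → IsOrder O' →
    SameType O O' ⇔
      (∃ λ c → ∃ λ d → NonzeroWithInv c d × (conjSet c d (O ᵀ) ≐ (O' ᵀ)))
lemma3p6 _ _ a b _ O O' O-order O'-order = mk⇔ sameType⇒ ⇒sameType
  where
  open QuatAlg a b
  open QuaternionAlgebra a b
  module O = Order O-order
  module O' = Order O'-order

  sameType⇒ : SameType O O' → ∃ λ c → ∃ λ d → NonzeroWithInv c d × (conjSet c d (O ᵀ) ≐ (O' ᵀ))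
  sameType⇒ (c , d , c⁻¹@(_ , cd≡𝟙 , dc≡𝟙) , cOc⁻¹≐O') = c , d , c⁻¹ , ⊆⇒≐
    (λ y∈ → ᵀ-mono (≐⇒⊆ cOc⁻¹≐O') (≐⇒⊆ (conj-ᵀ c d cd≡𝟙 dc≡𝟙) y∈))
    (λ y∈ → ≐⇒⊇ (conj-ᵀ c d cd≡𝟙 dc≡𝟙) (ᵀ-mono (≐⇒⊇ cOc⁻¹≐O') y∈))

  ⇒sameType : (∃ λ c → ∃ λ d → NonzeroWithInv c d × (conjSet c d (O ᵀ) ≐ (O' ᵀ))) → SameType O O'
  ⇒sameType (c , d , c⁻¹@(_ , cd≡𝟙 , dc≡𝟙) , cOᵀc⁻¹≐O'ᵀ) = c , d , c⁻¹ , ⊆⇒≐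
    (ᵀ-reflects-⊆ cOc⁻¹-integral O'.traceNormIntegral O'.translationClosed
      (λ y∈ → ≐⇒⊆ cOᵀc⁻¹≐O'ᵀ (≐⇒⊇ (conj-ᵀ c d cd≡𝟙 dc≡𝟙) y∈)))
    (ᵀ-reflects-⊆ O'.traceNormIntegral cOc⁻¹-integral (conj-translationClosed c d cd≡𝟙 O.translationClosed)
      (λ y∈ → ≐⇒⊆ (conj-ᵀ c d cd≡𝟙 dc≡𝟙) (≐⇒⊇ cOᵀc⁻¹≐O'ᵀ y∈)))
    where
    cOc⁻¹-integral : TraceNormIntegral (conjSet c d O)
    cOc⁻¹-integral = conj-traceNormIntegral c d cd≡𝟙 dc≡𝟙 O.traceNormIntegral
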